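{- Let $\Gamma$ be a set of formulas; $\mathbf{LV}+\Gamma$ is the logic preserving degrees of truth of the subvariety of $\mathsf V$-algebras axiomatized by $\tau(\Gamma)=\{\gamma\approx1:\gamma\in\Gamma\}$.
   Context: $\mathbf{LV}$ is the smallest finitary consequence relation in the language $\{\land,\lor,\to,\mathbin{\Box\!\!\rightarrow},0,1\}$ containing classical axioms and (L1) $\varphi\mathbin{\Box\!\!\rightarrow}\varphi$, (L2) $((\varphi\mathbin{\Box\!\!\rightarrow}\psi)\wedge(\psi\mathbin{\Box\!\!\rightarrow}\varphi))\to((\varphi\mathbin{\Box\!\!\rightarrow}\gamma)\leftrightarrow(\psi\mathbin{\Box\!\!\rightarrow}\gamma))$, (L3) $((\varphi\vee\psi)\mathbin{\Box\!\!\rightarrow}\varphi)\vee((\varphi\vee\psi)\mathbin{\Box\!\!\rightarrow}\psi)\vee(((\varphi\vee\psi)\mathbin{\Box\!\!\rightarrow}\gamma)\leftrightarrow((\varphi\mathbin{\Box\!\!\rightarrow}\gamma)\wedge(\psi\mathbin{\Box\!\!\rightarrow}\gamma)))$, (L4) $(\varphi\mathbin{\Box\!\!\rightarrow}(\psi\land\gamma))\leftrightarrow((\varphi\mathbin{\Box\!\!\rightarrow}\psi)\land(\varphi\mathbin{\Box\!\!\rightarrow}\gamma))$, closed under modus ponens and: if $\vdash\varphi\to\psi$ then $\vdash(\gamma\mathbin{\Box\!\!\rightarrow}\varphi)\to(\gamma\mathbin{\Box\!\!\rightarrow}\psi)$; $\mathbf{LV}+\Gamma$ is its axiomatic extension by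 $\Gamma$. $\mathsf V$-algebras are Boolean algebras with a binary operation $\mathbin{\Box\!\!\rightarrow}$ satisfying $x\mathbin{\Box\!\!\rightarrow}x=1$, $((x\mathbin{\Box\!\!\rightarrow}y)\wedge(y\mathbin{\Box\!\!\rightarrow}x))\le((x\mathbin{\Box\!\!\rightarrow}z)\leftrightarrow(y\mathbin{\Box\!\!\rightarrow}z))$, $((x\vee y)\mathbin{\Box\!\!\rightarrow}x)\vee((x\vee y)\mathbin{\Box\!\!\rightarrow}y)\vee(((x\vee y)\mathbin{\Box\!\!\rightarrow}z)\leftrightarrow((x\mathbin{\Box\!\!\rightarrow}z)\wedge(y\mathbin{\Box\!\!\rightarrow}z)))=1$, $x\mathbin{\Box\!\!\rightarrow}(y\wedge z)=(x\mathbin{\Box\!\!\rightarrow}y)\wedge(x\mathbin{\Box\!\!\rightarrow}z)$. The degree-preserving logic of a class $\mathsf K$: $\Delta\vdash\varphi$ iff for all $\mathbf A\in\mathsf K$, assignments $h$, $a\in A$: $a\le h(\delta)$ for all $\delta\in\Delta$ implies $a\le h(\varphi)$. -}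

module Defs where

open import Level using (0ℓ)
open import Data.Nat using (ℕ)
open import Data.Product using (_×_)
open import Algebra.Core using (Op₂)
open import Algebra.Lattice.Bundles using (BooleanAlgebra)
open import Relation.Binary.Core using (Rel)

infixr 7 _∧'_
infixr 6 _∨'_
infixr 5 _⇒_
infixr 5 _□⇒_

data Formula : Set where
  var   : ℕ → Formula
  _∧'_  : Formula → Formula → Formula
  _∨'_  : Formula → Formula → Formula
  _⇒_   : Formula → Formula → Formula
  _□⇒_  : Formula → Formula → Formula
  𝟘 𝟙   : Formula

_⇔'_ : Formula → Formula → Formula
φ ⇔' ψ = (φ ⇒ ψ) ∧' (ψ ⇒ φ)

Subst : Set
Subst = ℕ → Formula

_[_] : Formula → Subst → Formula
var n    [ σ ] = σ n
(φ ∧' ψ) [ σ ] = (φ [ σ ]) ∧' (ψ [ σ ])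
(φ ∨' ψ) [ σ ] = (φ [ σ ]) ∨' (ψ [ σ ])
(φ ⇒ ψ)  [ σ ] = (φ [ σ ]) ⇒ (ψ [ σ ])
(φ □⇒ ψ) [ σ ] = (φ [ σ ]) □⇒ (ψ [ σ ])
𝟘        [ σ ] = 𝟘
𝟙        [ σ ] = 𝟙

FSet : Set₁
FSet = Formula → Set

data Axiom : Formula → Set where
  ax-K   : ∀ φ ψ → Axiom (φ ⇒ ψ ⇒ φ)
  ax-S   : ∀ φ ψ χ → Axiom ((φ ⇒ ψ ⇒ χ) ⇒ (φ ⇒ ψ) ⇒ φ ⇒ χ)
  ax-∧E₁ : ∀ φ ψ → Axiom (φ ∧' ψ ⇒ φ)
  ax-∧E₂ : ∀ φ ψ → Axiom (φ ∧' ψ ⇒ ψ)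
  ax-∧I  : ∀ φ ψ → Axiom (φ ⇒ ψ ⇒ φ ∧' ψ)
  ax-∨I₁ : ∀ φ ψ → Axiom (φ ⇒ φ ∨' ψ)
  ax-∨I₂ : ∀ φ ψ → Axiom (ψ ⇒ φ ∨' ψ)
  ax-∨E  : ∀ φ ψ χ → Axiom ((φ ⇒ χ) ⇒ (ψ ⇒ χ) ⇒ φ ∨' ψ ⇒ χ)
  ax-𝟘   : ∀ φ → Axiom (𝟘 ⇒ φ)
  ax-𝟙   : ∀ φ → Axiom (φ ⇒ 𝟙)
  ax-DN  : ∀ φ → Axiom (((φ ⇒ 𝟘) ⇒ 𝟘) ⇒ φ)
  ax-L1  : ∀ φ → Axiom (φ □⇒ φ)
  ax-L2  : ∀ φ ψ γ → Axiom (((φ □⇒ ψ) ∧' (ψ □⇒ φ)) ⇒ ((φ □⇒ γ) ⇔' (ψ □⇒ γ)))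
  ax-L3  : ∀ φ ψ γ → Axiom (((φ ∨' ψ) □⇒ φ) ∨' ((φ ∨' ψ) □⇒ ψ)
                            ∨' (((φ ∨' ψ) □⇒ γ) ⇔' ((φ □⇒ γ) ∧' (ψ □⇒ γ))))
  ax-L4  : ∀ φ ψ γ → Axiom ((φ □⇒ (ψ ∧' γ)) ⇔' ((φ □⇒ ψ) ∧' (φ □⇒ γ)))

data Thm (Γ : FSet) : Formula → Set where
  axiom : ∀ {φ} → Axiom φ → Thm Γ φ
  ext   : ∀ {γ} → Γ γ → (σ : Subst) → Thm Γ (γ [ σ ])
  mp    : ∀ {φ ψ} → Thm Γ (φ ⇒ ψ) → Thm Γ φ → Thm Γ ψ
  rcm   : ∀ {φ ψ} γ → Thm Γ (φ ⇒ ψ) → Thm Γ ((γ □⇒ φ) ⇒ (γ □⇒ ψ))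

-- Consequence relation of LV + Γ: Δ ⊢ φ iff φ is derivable from the
-- premises Δ and the theorems of LV + Γ by modus ponens (the monotone
-- rule applies to theorems only).
data _⊢[_]_ (Δ : FSet) (Γ : FSet) : Formula → Set where
  thm  : ∀ {φ} → Thm Γ φ → Δ ⊢[ Γ ] φ
  hyp  : ∀ {φ} → Δ φ → Δ ⊢[ Γ ] φ
  mp   : ∀ {φ ψ} → Δ ⊢[ Γ ] (φ ⇒ ψ) → Δ ⊢[ Γ ] φ → Δ ⊢[ Γ ] ψ

record VAlgebra : Set₁ where
  infixr 5 _□→_
  field
    boolean : BooleanAlgebra 0ℓ 0ℓ
  open BooleanAlgebra boolean public
  infixr 5 _↝_
  infix 5 _↔_
  _↝_ : Op₂ Carrier
  x ↝ y = (¬ x) ∨ y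
  _↔_ : Op₂ Carrier
  x ↔ y = (x ↝ y) ∧ (y ↝ x)
  _≤_ : Rel Carrier 0ℓ
  x ≤ y = (x ∧ y) ≈ x
  field
    _□→_     : Op₂ Carrier
    □→-cong  : ∀ {x x' y y'} → x ≈ x' → y ≈ y' → (x □→ y) ≈ (x' □→ y')
    V1 : ∀ x → (x □→ x) ≈ ⊤
    V2 : ∀ x y z → ((x □→ y) ∧ (y □→ x)) ≤ ((x □→ z) ↔ (y □→ z))
    V3 : ∀ x y z → (((x ∨ y) □→ x) ∨ ((x ∨ y) □→ y)
                    ∨ (((x ∨ y) □→ z) ↔ ((x □→ z) ∧ (y □→ z)))) ≈ ⊤
    V4 : ∀ x y z → (x □→ (y ∧ z)) ≈ ((x □→ y) ∧ (x □→ z))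

module _ (A : VAlgebra) where
  open VAlgebra A

  ⟦_⟧ : Formula → (ℕ → Carrier) → Carrier
  ⟦ var n  ⟧ h = h n
  ⟦ φ ∧' ψ ⟧ h = ⟦ φ ⟧ h ∧ ⟦ ψ ⟧ h
  ⟦ φ ∨' ψ ⟧ h = ⟦ φ ⟧ h ∨ ⟦ ψ ⟧ h
  ⟦ φ ⇒ ψ  ⟧ h = ⟦ φ ⟧ h ↝ ⟦ ψ ⟧ h
  ⟦ φ □⇒ ψ ⟧ h = ⟦ φ ⟧ h □→ ⟦ ψ ⟧ h
  ⟦ 𝟘 ⟧ h = ⊥
  ⟦ 𝟙 ⟧ h = ⊤

Satisfies : FSet → VAlgebra → Set
Satisfies Γ A = ∀ {γ} → Γ γ → ∀ (h : ℕ → VAlgebra.Carrier A) →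
                VAlgebra._≈_ A (⟦ A ⟧ γ h) (VAlgebra.⊤ A)

_⊨≤[_]_ : FSet → FSet → Formula → Set₁
Δ ⊨≤[ Γ ] φ = ∀ (A : VAlgebra) → Satisfies Γ A →
              ∀ (h : ℕ → VAlgebra.Carrier A) (a : VAlgebra.Carrier A) →
              (∀ {δ} → Δ δ → VAlgebra._≤_ A a (⟦ A ⟧ δ h)) →
              VAlgebra._≤_ A a (⟦ A ⟧ φ h)

{-# OPTIONS --safe #-}
module Submission where

-- For completeness, the formulas modulo provable
-- equivalence in any theory containing LV and closed under its rules form a V-algebra, the
-- Lindenbaum algebra.  To obtain one degree below all of Δ, add a fresh variable p₀ with the
-- axioms p₀ → δ for δ ∈ Δ: the Lindenbaum algebra of this extension satisfies τ(Γ), so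
-- Δ ⊨≤ φ yields p₀ → φ there.  That derivation uses finitely many premises δ₁, …, δₙ, and
-- substituting δ₁ ∧ … ∧ δₙ for p₀ turns it into a proof of δ₁ ∧ … ∧ δₙ → φ in LV + Γ.

open import Defs
open import Level using (0ℓ)
open import Data.Nat using (zero; suc)
open import Data.Product using (_×_; _,_; proj₁; proj₂; ∃-syntax)
open import Data.List using (List; []; _∷_; _++_)
open import Data.List.Membership.Propositional using (_∈_)
open import Data.List.Relation.Unary.Any using (here; there)
open import Data.List.Relation.Unary.All using (All; []; _∷_)
open import Data.List.Relation.Unary.All.Properties using (++⁺)
open import Data.List.Relation.Binary.Subset.Propositional using (_⊆_)
open import Data.List.Relation.Binary.Subset.Propositional.Properties
  using (⊆-refl; ⊆-trans; xs⊆xs++ys; xs⊆ys++xs)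
open import Relation.Binary.PropositionalEquality as ≡ using (_≡_; refl; cong₂; subst)
open import Algebra.Lattice.Bundles using (BooleanAlgebra)
import Algebra.Lattice.Properties.BooleanAlgebra as BooleanAlgebraProperties
import Algebra.Lattice.Properties.Lattice as LatticeProperties
import Relation.Binary.Lattice.Bundles as OrderTheoretic
import Relation.Binary.Reasoning.Setoid as SetoidReasoning

⟦⟧-[] : ∀ (A : VAlgebra) φ σ h → ⟦ A ⟧ (φ [ σ ]) h ≡ ⟦ A ⟧ φ (λ n → ⟦ A ⟧ (σ n) h)
⟦⟧-[] A (var n)  σ h = refl
⟦⟧-[] A (φ ∧' ψ) σ h = cong₂ (VAlgebra._∧_ A) (⟦⟧-[] A φ σ h) (⟦⟧-[] A ψ σ h)
⟦⟧-[] A (φ ∨' ψ) σ h = cong₂ (VAlgebra._∨_ A) (⟦⟧-[] A φ σ h) (⟦⟧-[] A ψ σ h)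
⟦⟧-[] A (φ ⇒ ψ)  σ h = cong₂ (VAlgebra._↝_ A) (⟦⟧-[] A φ σ h) (⟦⟧-[] A ψ σ h)
⟦⟧-[] A (φ □⇒ ψ) σ h = cong₂ (VAlgebra._□→_ A) (⟦⟧-[] A φ σ h) (⟦⟧-[] A ψ σ h)
⟦⟧-[] A 𝟘        σ h = refl
⟦⟧-[] A 𝟙        σ h = refl

[]-[] : ∀ φ σ τ → φ [ σ ] [ τ ] ≡ φ [ (λ n → σ n [ τ ]) ]
[]-[] (var n)  σ τ = refl
[]-[] (φ ∧' ψ) σ τ = cong₂ _∧'_ ([]-[] φ σ τ) ([]-[] ψ σ τ)
[]-[] (φ ∨' ψ) σ τ = cong₂ _∨'_ ([]-[] φ σ τ) ([]-[] ψ σ τ)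
[]-[] (φ ⇒ ψ)  σ τ = cong₂ _⇒_  ([]-[] φ σ τ) ([]-[] ψ σ τ)
[]-[] (φ □⇒ ψ) σ τ = cong₂ _□⇒_ ([]-[] φ σ τ) ([]-[] ψ σ τ)
[]-[] 𝟘        σ τ = refl
[]-[] 𝟙        σ τ = refl

[]-var : ∀ φ → φ [ var ] ≡ φ
[]-var (var n)  = refl
[]-var (φ ∧' ψ) = cong₂ _∧'_ ([]-var φ) ([]-var ψ)
[]-var (φ ∨' ψ) = cong₂ _∨'_ ([]-var φ) ([]-var ψ)
[]-var (φ ⇒ ψ)  = cong₂ _⇒_  ([]-var φ) ([]-var ψ)
[]-var (φ □⇒ ψ) = cong₂ _□⇒_ ([]-var φ) ([]-var ψ)
[]-var 𝟘        = refl
[]-var 𝟙        = refl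

shift : Subst
shift n = var (suc n)

unshift : Formula → Subst
unshift χ zero    = χ
unshift χ (suc n) = var n

[]-shift-unshift : ∀ φ χ → φ [ shift ] [ unshift χ ] ≡ φ
[]-shift-unshift φ χ rewrite []-[] φ shift (unshift χ) = []-var φ

Axiom-[] : ∀ {φ} → Axiom φ → ∀ σ → Axiom (φ [ σ ])
Axiom-[] (ax-K φ ψ)     σ = ax-K _ _
Axiom-[] (ax-S φ ψ χ)   σ = ax-S _ _ _
Axiom-[] (ax-∧E₁ φ ψ)   σ = ax-∧E₁ _ _
Axiom-[] (ax-∧E₂ φ ψ)   σ = ax-∧E₂ _ _
Axiom-[] (ax-∧I φ ψ)    σ = ax-∧I _ _
Axiom-[] (ax-∨I₁ φ ψ)   σ = ax-∨I₁ _ _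
Axiom-[] (ax-∨I₂ φ ψ)   σ = ax-∨I₂ _ _
Axiom-[] (ax-∨E φ ψ χ)  σ = ax-∨E _ _ _
Axiom-[] (ax-𝟘 φ)       σ = ax-𝟘 _
Axiom-[] (ax-𝟙 φ)       σ = ax-𝟙 _
Axiom-[] (ax-DN φ)      σ = ax-DN _
Axiom-[] (ax-L1 φ)      σ = ax-L1 _
Axiom-[] (ax-L2 φ ψ γ)  σ = ax-L2 _ _ _
Axiom-[] (ax-L3 φ ψ γ)  σ = ax-L3 _ _ _
Axiom-[] (ax-L4 φ ψ γ)  σ = ax-L4 _ _ _

module VAlgebraProperties (A : VAlgebra) where
  open VAlgebra A renaming (refl to ≈-refl)
  open BooleanAlgebraProperties boolean
    using (∧-identityʳ; ∧-zeroˡ; ∨-identityˡ; ∨-identityʳ; ¬-involutive)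
  open LatticeProperties lattice using (∨-∧-orderTheoreticLattice)
  open SetoidReasoning setoid

  -- The library's lattice order is x ≈ x ∧ y, that of VAlgebra is x ∧ y ≈ x.
  private
    module Order = OrderTheoretic.Lattice ∨-∧-orderTheoreticLattice

    fromOrder : ∀ {x y} → x Order.≤ y → x ≤ y
    fromOrder = sym

    toOrder : ∀ {x y} → x ≤ y → x Order.≤ y
    toOrder = sym

  ≤-refl : ∀ {x} → x ≤ x
  ≤-refl = fromOrder Order.refl

  ≤-reflexive : ∀ {x y} → x ≈ y → x ≤ y
  ≤-reflexive x≈y = fromOrder (Order.reflexive x≈y)

  ≤-trans : ∀ {x y z} → x ≤ y → y ≤ z → x ≤ z
  ≤-trans x≤y y≤z = fromOrder (Order.trans (toOrder x≤y) (toOrder y≤z))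

  x∧y≤x : ∀ x y → (x ∧ y) ≤ x
  x∧y≤x x y = fromOrder (Order.x∧y≤x x y)

  x∧y≤y : ∀ x y → (x ∧ y) ≤ y
  x∧y≤y x y = fromOrder (Order.x∧y≤y x y)

  ∧-greatest : ∀ {x y z} → x ≤ y → x ≤ z → x ≤ (y ∧ z)
  ∧-greatest x≤y x≤z = fromOrder (Order.∧-greatest (toOrder x≤y) (toOrder x≤z))

  x≤x∨y : ∀ x y → x ≤ (x ∨ y)
  x≤x∨y x y = fromOrder (Order.x≤x∨y x y)

  y≤x∨y : ∀ x y → y ≤ (x ∨ y)
  y≤x∨y x y = fromOrder (Order.y≤x∨y x y)

  ∨-least : ∀ {x y z} → x ≤ z → y ≤ z → (x ∨ y) ≤ z
  ∨-least x≤z y≤z = fromOrder (Order.∨-least (toOrder x≤z) (toOrder y≤z))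

  x≤⊤ : ∀ x → x ≤ ⊤
  x≤⊤ = ∧-identityʳ

  ⊥≤x : ∀ x → ⊥ ≤ x
  ⊥≤x = ∧-zeroˡ

  ≤-≈⊤ : ∀ {a x} → x ≈ ⊤ → a ≤ x
  ≤-≈⊤ {a} x≈⊤ = ≤-trans (x≤⊤ a) (≤-reflexive (sym x≈⊤))

  ↝-∧ : ∀ x y → (x ↝ y) ∧ x ≈ y ∧ x
  ↝-∧ x y = begin
    (¬ x ∨ y) ∧ x        ≈⟨ proj₂ ∧-distrib-∨ x (¬ x) y ⟩
    (¬ x ∧ x) ∨ (y ∧ x)  ≈⟨ ∨-congʳ (∧-complementˡ x) ⟩
    ⊥ ∨ (y ∧ x)          ≈⟨ ∨-identityˡ _ ⟩
    y ∧ x                ∎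

  ∧-∨-split : ∀ a x → a ≈ (a ∧ x) ∨ (a ∧ ¬ x)
  ∧-∨-split a x = begin
    a                    ≈⟨ sym (∧-identityʳ a) ⟩
    a ∧ ⊤                ≈⟨ ∧-congˡ (sym (∨-complementʳ x)) ⟩
    a ∧ (x ∨ ¬ x)        ≈⟨ proj₁ ∧-distrib-∨ a x (¬ x) ⟩
    (a ∧ x) ∨ (a ∧ ¬ x)  ∎

  ↝-elim : ∀ {a x y} → a ≤ (x ↝ y) → a ≤ x → a ≤ y
  ↝-elim {x = x} {y} a≤x↝y a≤x =
    ≤-trans (∧-greatest a≤x↝y a≤x) (≤-trans (≤-reflexive (↝-∧ x y)) (x∧y≤x y x))

  ↝-intro : ∀ {a x y} → (a ∧ x) ≤ y → a ≤ (x ↝ y)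
  ↝-intro {a} {x} {y} a∧x≤y = ≤-trans (≤-reflexive (∧-∨-split a x))
    (∨-least (≤-trans a∧x≤y (y≤x∨y (¬ x) y)) (≤-trans (x∧y≤y a (¬ x)) (x≤x∨y (¬ x) y)))

  ↝-intro-≤ : ∀ {a x y} → x ≤ y → a ≤ (x ↝ y)
  ↝-intro-≤ {a} {x} x≤y = ↝-intro (≤-trans (x∧y≤y a x) x≤y)

  □→-monoʳ : ∀ {g x y} → x ≤ y → (g □→ x) ≤ (g □→ y)
  □→-monoʳ {g} {x} {y} x≤y = begin
    (g □→ x) ∧ (g □→ y)  ≈⟨ sym (V4 g x y) ⟩
    g □→ (x ∧ y)         ≈⟨ □→-cong ≈-refl x≤y ⟩
    g □→ x               ∎

  ¬¬x∨⊥∨⊥≈x : ∀ x → ¬ (¬ x ∨ ⊥) ∨ ⊥ ≈ x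
  ¬¬x∨⊥∨⊥≈x x = begin
    ¬ (¬ x ∨ ⊥) ∨ ⊥  ≈⟨ ∨-identityʳ _ ⟩
    ¬ (¬ x ∨ ⊥)      ≈⟨ ¬-cong (∨-identityʳ _) ⟩
    ¬ ¬ x            ≈⟨ ¬-involutive x ⟩
    x                ∎

  Axiom-valid : ∀ {φ} → Axiom φ → ∀ h {a} → a ≤ ⟦ A ⟧ φ h
  Axiom-valid (ax-K φ ψ)    h = ↝-intro (↝-intro (≤-trans (x∧y≤x _ _) (x∧y≤y _ _)))
  Axiom-valid (ax-S φ ψ χ)  h = ↝-intro (↝-intro (↝-intro
    (↝-elim (↝-elim (≤-trans (x∧y≤x _ _) (≤-trans (x∧y≤x _ _) (x∧y≤y _ _))) (x∧y≤y _ _))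
            (↝-elim (≤-trans (x∧y≤x _ _) (x∧y≤y _ _)) (x∧y≤y _ _)))))
  Axiom-valid (ax-∧E₁ φ ψ)  h = ↝-intro-≤ (x∧y≤x _ _)
  Axiom-valid (ax-∧E₂ φ ψ)  h = ↝-intro-≤ (x∧y≤y _ _)
  Axiom-valid (ax-∧I φ ψ)   h = ↝-intro (↝-intro
    (∧-greatest (≤-trans (x∧y≤x _ _) (x∧y≤y _ _)) (x∧y≤y _ _)))
  Axiom-valid (ax-∨I₁ φ ψ)  h = ↝-intro-≤ (x≤x∨y _ _)
  Axiom-valid (ax-∨I₂ φ ψ)  h = ↝-intro-≤ (y≤x∨y _ _)
  Axiom-valid (ax-∨E φ ψ χ) h = ↝-intro (↝-intro (↝-intro
    (≤-trans (≤-reflexive (proj₁ ∧-distrib-∨ _ _ _))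
      (∨-least (↝-elim (≤-trans (x∧y≤x _ _) (≤-trans (x∧y≤x _ _) (x∧y≤y _ _))) (x∧y≤y _ _))
               (↝-elim (≤-trans (x∧y≤x _ _) (x∧y≤y _ _)) (x∧y≤y _ _))))))
  Axiom-valid (ax-𝟘 φ)      h = ↝-intro-≤ (⊥≤x _)
  Axiom-valid (ax-𝟙 φ)      h = ↝-intro-≤ (x≤⊤ _)
  Axiom-valid (ax-DN φ)     h = ↝-intro-≤ (≤-reflexive (¬¬x∨⊥∨⊥≈x _))
  Axiom-valid (ax-L1 φ)     h = ≤-≈⊤ (V1 _)
  Axiom-valid (ax-L2 φ ψ γ) h = ↝-intro-≤ (V2 _ _ _)
  Axiom-valid (ax-L3 φ ψ γ) h = ≤-≈⊤ (V3 _ _ _)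
  Axiom-valid (ax-L4 φ ψ γ) h =
    ∧-greatest (↝-intro-≤ (≤-reflexive (V4 _ _ _))) (↝-intro-≤ (≤-reflexive (sym (V4 _ _ _))))

  Thm-valid : ∀ {Γ φ} → Satisfies Γ A → Thm Γ φ → ∀ h {a} → a ≤ ⟦ A ⟧ φ h
  Thm-valid sat (axiom ax)      h = Axiom-valid ax h
  Thm-valid sat (ext {γ} γ∈Γ σ) h rewrite ⟦⟧-[] A γ σ h = ≤-≈⊤ (sat γ∈Γ _)
  Thm-valid sat (mp ⊢φ⇒ψ ⊢φ)    h = ↝-elim (Thm-valid sat ⊢φ⇒ψ h) (Thm-valid sat ⊢φ h)
  Thm-valid sat (rcm _ ⊢φ⇒ψ)    h = ↝-intro-≤ (□→-monoʳ (↝-elim (Thm-valid sat ⊢φ⇒ψ h) ≤-refl))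

soundness : ∀ {Γ Δ φ} → Δ ⊢[ Γ ] φ → Δ ⊨≤[ Γ ] φ
soundness (thm ⊢φ)      A sat h _ _   = VAlgebraProperties.Thm-valid A sat ⊢φ h
soundness (hyp δ∈Δ)     _ _   _ _ a≤Δ = a≤Δ δ∈Δ
soundness (mp ⊢φ⇒ψ ⊢φ)  A sat h a a≤Δ =
  VAlgebraProperties.↝-elim A (soundness ⊢φ⇒ψ A sat h a a≤Δ) (soundness ⊢φ A sat h a a≤Δ)

module Derivations (T : FSet) (T-axiom : ∀ {φ} → Axiom φ → T φ)
                   (T-mp : ∀ {φ ψ} → T (φ ⇒ ψ) → T φ → T ψ) where

  infix 2 _⊩_
  data _⊩_ (G : List Formula) : Formula → Set where
    theory : ∀ {φ} → T φ → G ⊩ φ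
    assume : ∀ {φ} → φ ∈ G → G ⊩ φ
    ⇒E     : ∀ {φ ψ} → G ⊩ φ ⇒ ψ → G ⊩ φ → G ⊩ ψ

  discharge : ∀ {φ} → [] ⊩ φ → T φ
  discharge (theory ⊢φ) = ⊢φ
  discharge (⇒E d e)    = T-mp (discharge d) (discharge e)

  weaken : ∀ {G φ ψ} → G ⊩ φ → ψ ∷ G ⊩ φ
  weaken (theory ⊢φ) = theory ⊢φ
  weaken (assume φ∈G) = assume (there φ∈G)
  weaken (⇒E d e)     = ⇒E (weaken d) (weaken e)

  by-axiom : ∀ {G φ} → Axiom φ → G ⊩ φ
  by-axiom ax = theory (T-axiom ax)

  via : ∀ {G φ ψ} → T (φ ⇒ ψ) → G ⊩ φ → G ⊩ ψ
  via ⊢φ⇒ψ = ⇒E (theory ⊢φ⇒ψ)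

  #0 : ∀ {G φ} → φ ∷ G ⊩ φ
  #0 = assume (here refl)

  #1 : ∀ {G φ ψ} → ψ ∷ φ ∷ G ⊩ φ
  #1 = assume (there (here refl))

  ⇒-refl : ∀ {G φ} → G ⊩ φ ⇒ φ
  ⇒-refl {φ = φ} = ⇒E (⇒E (by-axiom (ax-S φ (φ ⇒ φ) φ)) (by-axiom (ax-K φ (φ ⇒ φ)))) (by-axiom (ax-K φ φ))

  ⇒I : ∀ {G φ ψ} → φ ∷ G ⊩ ψ → G ⊩ φ ⇒ ψ
  ⇒I (theory ⊢ψ)             = ⇒E (by-axiom (ax-K _ _)) (theory ⊢ψ)
  ⇒I (assume (here refl))    = ⇒-refl
  ⇒I (assume (there ψ∈G))    = ⇒E (by-axiom (ax-K _ _)) (assume ψ∈G)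
  ⇒I (⇒E d e)                = ⇒E (⇒E (by-axiom (ax-S _ _ _)) (⇒I d)) (⇒I e)

  ∧I : ∀ {G φ ψ} → G ⊩ φ → G ⊩ ψ → G ⊩ φ ∧' ψ
  ∧I d e = ⇒E (⇒E (by-axiom (ax-∧I _ _)) d) e

  ∧E₁ : ∀ {G φ ψ} → G ⊩ φ ∧' ψ → G ⊩ φ
  ∧E₁ = ⇒E (by-axiom (ax-∧E₁ _ _))

  ∧E₂ : ∀ {G φ ψ} → G ⊩ φ ∧' ψ → G ⊩ ψ
  ∧E₂ = ⇒E (by-axiom (ax-∧E₂ _ _))

  ∨I₁ : ∀ {G φ ψ} → G ⊩ φ → G ⊩ φ ∨' ψ
  ∨I₁ = ⇒E (by-axiom (ax-∨I₁ _ _))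

  ∨I₂ : ∀ {G φ ψ} → G ⊩ ψ → G ⊩ φ ∨' ψ
  ∨I₂ = ⇒E (by-axiom (ax-∨I₂ _ _))

  ∨E : ∀ {G φ ψ χ} → G ⊩ φ ∨' ψ → φ ∷ G ⊩ χ → ψ ∷ G ⊩ χ → G ⊩ χ
  ∨E d e f = ⇒E (⇒E (⇒E (by-axiom (ax-∨E _ _ _)) (⇒I e)) (⇒I f)) d

  𝟘E : ∀ {G φ} → G ⊩ 𝟘 → G ⊩ φ
  𝟘E = ⇒E (by-axiom (ax-𝟘 _))

  𝟙I : ∀ {G} → G ⊩ 𝟙
  𝟙I = ⇒E (by-axiom (ax-𝟙 (𝟘 ⇒ 𝟘))) (by-axiom (ax-𝟘 𝟘))

  RAA : ∀ {G φ} → (φ ⇒ 𝟘) ∷ G ⊩ 𝟘 → G ⊩ φ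
  RAA d = ⇒E (by-axiom (ax-DN _)) (⇒I d)

  ∨-comm : ∀ {G φ ψ} → G ⊩ φ ∨' ψ → G ⊩ ψ ∨' φ
  ∨-comm d = ∨E d (∨I₂ #0) (∨I₁ #0)

  ∧-comm : ∀ {G φ ψ} → G ⊩ φ ∧' ψ → G ⊩ ψ ∧' φ
  ∧-comm d = ∧I (∧E₂ d) (∧E₁ d)

  excluded-middle : ∀ {G φ} → G ⊩ φ ∨' (φ ⇒ 𝟘)
  excluded-middle = RAA (⇒E #0 (∨I₂ (⇒I (⇒E #1 (∨I₁ #0)))))

  ⇒-to-∨ : ∀ {G φ ψ} → G ⊩ φ ⇒ ψ → G ⊩ (φ ⇒ 𝟘) ∨' ψ
  ⇒-to-∨ d = ∨E excluded-middle (∨I₂ (⇒E (weaken d) #0)) (∨I₁ #0)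

  ∨-to-⇒ : ∀ {G φ ψ} → G ⊩ (φ ⇒ 𝟘) ∨' ψ → G ⊩ φ ⇒ ψ
  ∨-to-⇒ d = ⇒I (∨E (weaken d) (𝟘E (⇒E #0 #1)) #0)

ContainsInstances : FSet → FSet → Set
ContainsInstances Γ T = ∀ {γ} → Γ γ → ∀ σ → T (γ [ σ ])

record IsTheory (T : FSet) : Set where
  field
    T-axiom : ∀ {φ} → Axiom φ → T φ
    T-mp    : ∀ {φ ψ} → T (φ ⇒ ψ) → T φ → T ψ
    T-rcm   : ∀ {φ ψ} γ → T (φ ⇒ ψ) → T ((γ □⇒ φ) ⇒ (γ □⇒ ψ))

module Lindenbaum {T : FSet} (isTheory : IsTheory T) where
  open IsTheory isTheory
  open Derivations T T-axiom T-mp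

  infix 4 _⊣⊢_
  _⊣⊢_ : Formula → Formula → Set
  φ ⊣⊢ ψ = T (φ ⇒ ψ) × T (ψ ⇒ φ)

  ⊣⊢-intro : ∀ {φ ψ} → φ ∷ [] ⊩ ψ → ψ ∷ [] ⊩ φ → φ ⊣⊢ ψ
  ⊣⊢-intro d e = discharge (⇒I d) , discharge (⇒I e)

  ⊣⊢-refl : ∀ {φ} → φ ⊣⊢ φ
  ⊣⊢-refl = ⊣⊢-intro #0 #0

  ⊣⊢-sym : ∀ {φ ψ} → φ ⊣⊢ ψ → ψ ⊣⊢ φ
  ⊣⊢-sym (⊢φ⇒ψ , ⊢ψ⇒φ) = ⊢ψ⇒φ , ⊢φ⇒ψ

  ⊣⊢-trans : ∀ {φ ψ χ} → φ ⊣⊢ ψ → ψ ⊣⊢ χ → φ ⊣⊢ χ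
  ⊣⊢-trans (⊢φ⇒ψ , ⊢ψ⇒φ) (⊢ψ⇒χ , ⊢χ⇒ψ) = ⊣⊢-intro (via ⊢ψ⇒χ (via ⊢φ⇒ψ #0)) (via ⊢ψ⇒φ (via ⊢χ⇒ψ #0))

  ∧-cong : ∀ {φ φ' ψ ψ'} → φ ⊣⊢ φ' → ψ ⊣⊢ ψ' → φ ∧' ψ ⊣⊢ φ' ∧' ψ'
  ∧-cong (p , p') (q , q') = ⊣⊢-intro (∧I (via p (∧E₁ #0)) (via q (∧E₂ #0)))
                                      (∧I (via p' (∧E₁ #0)) (via q' (∧E₂ #0)))

  ∨-cong : ∀ {φ φ' ψ ψ'} → φ ⊣⊢ φ' → ψ ⊣⊢ ψ' → φ ∨' ψ ⊣⊢ φ' ∨' ψ'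
  ∨-cong (p , p') (q , q') = ⊣⊢-intro (∨E #0 (∨I₁ (via p #0)) (∨I₂ (via q #0)))
                                      (∨E #0 (∨I₁ (via p' #0)) (∨I₂ (via q' #0)))

  ¬-cong : ∀ {φ φ'} → φ ⊣⊢ φ' → φ ⇒ 𝟘 ⊣⊢ φ' ⇒ 𝟘
  ¬-cong (p , p') = ⊣⊢-intro (⇒I (⇒E #1 (via p' #0))) (⇒I (⇒E #1 (via p #0)))

  ¬∨⊣⊢⇒ : ∀ {φ ψ} → (φ ⇒ 𝟘) ∨' ψ ⊣⊢ φ ⇒ ψ
  ¬∨⊣⊢⇒ = ⊣⊢-intro (∨-to-⇒ #0) (⇒-to-∨ #0)

  □⇒-congʳ : ∀ {φ ψ ψ'} → ψ ⊣⊢ ψ' → φ □⇒ ψ ⊣⊢ φ □⇒ ψ'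
  □⇒-congʳ {φ} (p , p') = T-rcm φ p , T-rcm φ p'

  -- Interderivable antecedents entail each other (by (L1) and the monotony rule), so (L2) applies.
  □⇒-congˡ : ∀ {φ φ' ψ} → φ ⊣⊢ φ' → φ □⇒ ψ ⊣⊢ φ' □⇒ ψ
  □⇒-congˡ {φ} {φ'} {ψ} (p , p') = ⊣⊢-intro (⇒E (∧E₁ L2) #0) (⇒E (∧E₂ L2) #0)
    where
    L2 : ∀ {G} → G ⊩ ((φ □⇒ ψ) ⇒ (φ' □⇒ ψ)) ∧' ((φ' □⇒ ψ) ⇒ (φ □⇒ ψ))
    L2 = ⇒E (by-axiom (ax-L2 φ φ' ψ))
            (∧I (theory (T-mp (T-rcm φ p) (T-axiom (ax-L1 φ))))
                (theory (T-mp (T-rcm φ' p') (T-axiom (ax-L1 φ')))))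

  □⇒-cong : ∀ {φ φ' ψ ψ'} → φ ⊣⊢ φ' → ψ ⊣⊢ ψ' → φ □⇒ ψ ⊣⊢ φ' □⇒ ψ'
  □⇒-cong φ⊣⊢φ' ψ⊣⊢ψ' = ⊣⊢-trans (□⇒-congʳ ψ⊣⊢ψ') (□⇒-congˡ φ⊣⊢φ')

  booleanAlgebra : BooleanAlgebra 0ℓ 0ℓ
  booleanAlgebra = record
    { Carrier = Formula ; _≈_ = _⊣⊢_ ; _∨_ = _∨'_ ; _∧_ = _∧'_ ; ¬_ = _⇒ 𝟘 ; ⊤ = 𝟙 ; ⊥ = 𝟘
    ; isBooleanAlgebra = record
      { isDistributiveLattice = record
        { isLattice = record
          { isEquivalence = record { refl = ⊣⊢-refl ; sym = ⊣⊢-sym ; trans = ⊣⊢-trans }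
          ; ∨-comm = λ _ _ → ⊣⊢-intro (∨-comm #0) (∨-comm #0)
          ; ∨-assoc = λ _ _ _ → ⊣⊢-intro
              (∨E #0 (∨E #0 (∨I₁ #0) (∨I₂ (∨I₁ #0))) (∨I₂ (∨I₂ #0)))
              (∨E #0 (∨I₁ (∨I₁ #0)) (∨E #0 (∨I₁ (∨I₂ #0)) (∨I₂ #0)))
          ; ∨-cong = ∨-cong
          ; ∧-comm = λ _ _ → ⊣⊢-intro (∧-comm #0) (∧-comm #0)
          ; ∧-assoc = λ _ _ _ → ⊣⊢-intro
              (∧I (∧E₁ (∧E₁ #0)) (∧I (∧E₂ (∧E₁ #0)) (∧E₂ #0)))
              (∧I (∧I (∧E₁ #0) (∧E₁ (∧E₂ #0))) (∧E₂ (∧E₂ #0)))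
          ; ∧-cong = ∧-cong
          ; absorptive = (λ _ _ → ⊣⊢-intro (∨E #0 #0 (∧E₁ #0)) (∨I₁ #0))
                       , (λ _ _ → ⊣⊢-intro (∧E₁ #0) (∧I #0 (∨I₁ #0)))
          }
        ; ∨-distrib-∧ =
            (λ _ _ _ → ⊣⊢-intro
              (∨E #0 (∧I (∨I₁ #0) (∨I₁ #0)) (∧I (∨I₂ (∧E₁ #0)) (∨I₂ (∧E₂ #0))))
              (∨E (∧E₁ #0) (∨I₁ #0) (∨E (∧E₂ #1) (∨I₁ #0) (∨I₂ (∧I #1 #0)))))
          , (λ _ _ _ → ⊣⊢-intro
              (∨E #0 (∧I (∨I₁ (∧E₁ #0)) (∨I₁ (∧E₂ #0))) (∧I (∨I₂ #0) (∨I₂ #0)))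
              (∨E (∧E₁ #0) (∨E (∧E₂ #1) (∨I₁ (∧I #1 #0)) (∨I₂ #0)) (∨I₂ #0)))
        ; ∧-distrib-∨ =
            (λ _ _ _ → ⊣⊢-intro
              (∨E (∧E₂ #0) (∨I₁ (∧I (∧E₁ #1) #0)) (∨I₂ (∧I (∧E₁ #1) #0)))
              (∨E #0 (∧I (∧E₁ #0) (∨I₁ (∧E₂ #0))) (∧I (∧E₁ #0) (∨I₂ (∧E₂ #0)))))
          , (λ _ _ _ → ⊣⊢-intro
              (∨E (∧E₁ #0) (∨I₁ (∧I #0 (∧E₂ #1))) (∨I₂ (∧I #0 (∧E₂ #1))))
              (∨E #0 (∧I (∨I₁ (∧E₁ #0)) (∧E₂ #0)) (∧I (∨I₂ (∧E₁ #0)) (∧E₂ #0))))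
        }
      ; ∨-complement = (λ _ → ⊣⊢-intro 𝟙I (∨-comm excluded-middle))
                     , (λ _ → ⊣⊢-intro 𝟙I excluded-middle)
      ; ∧-complement = (λ _ → ⊣⊢-intro (⇒E (∧E₁ #0) (∧E₂ #0)) (𝟘E #0))
                     , (λ _ → ⊣⊢-intro (⇒E (∧E₂ #0) (∧E₁ #0)) (𝟘E #0))
      ; ¬-cong = ¬-cong
      }
    }

  lindenbaum : VAlgebra
  lindenbaum = record
    { boolean = booleanAlgebra
    ; _□→_ = _□⇒_
    ; □→-cong = □⇒-cong
    ; V1 = λ φ → ⊣⊢-intro 𝟙I (by-axiom (ax-L1 φ))
    ; V2 = λ φ ψ γ → ⊣⊢-intro (∧E₁ #0)
        (∧I #0 (∧I (⇒-to-∨ (∧E₁ (⇒E (by-axiom (ax-L2 φ ψ γ)) #0)))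
                   (⇒-to-∨ (∧E₂ (⇒E (by-axiom (ax-L2 φ ψ γ)) #0)))))
    ; V3 = λ φ ψ γ → ⊣⊢-intro 𝟙I
        (∨E (by-axiom (ax-L3 φ ψ γ)) (∨I₁ #0)
          (∨E #0 (∨I₂ (∨I₁ #0)) (∨I₂ (∨I₂ (∧I (⇒-to-∨ (∧E₁ #0)) (⇒-to-∨ (∧E₂ #0)))))))
    ; V4 = λ φ ψ γ → ⊣⊢-intro (⇒E (∧E₁ (by-axiom (ax-L4 φ ψ γ))) #0)
                              (⇒E (∧E₂ (by-axiom (ax-L4 φ ψ γ))) #0)
    }

  ⟦⟧-lindenbaum : ∀ φ σ → ⟦ lindenbaum ⟧ φ σ ⊣⊢ φ [ σ ]
  ⟦⟧-lindenbaum (var n)  σ = ⊣⊢-refl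
  ⟦⟧-lindenbaum (φ ∧' ψ) σ = ∧-cong (⟦⟧-lindenbaum φ σ) (⟦⟧-lindenbaum ψ σ)
  ⟦⟧-lindenbaum (φ ∨' ψ) σ = ∨-cong (⟦⟧-lindenbaum φ σ) (⟦⟧-lindenbaum ψ σ)
  ⟦⟧-lindenbaum (φ ⇒ ψ)  σ =
    ⊣⊢-trans (∨-cong (¬-cong (⟦⟧-lindenbaum φ σ)) (⟦⟧-lindenbaum ψ σ)) ¬∨⊣⊢⇒
  ⟦⟧-lindenbaum (φ □⇒ ψ) σ = □⇒-cong (⟦⟧-lindenbaum φ σ) (⟦⟧-lindenbaum ψ σ)
  ⟦⟧-lindenbaum 𝟘        σ = ⊣⊢-refl
  ⟦⟧-lindenbaum 𝟙        σ = ⊣⊢-refl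

  lindenbaum-satisfies : ∀ {Γ} → ContainsInstances Γ T → Satisfies Γ lindenbaum
  lindenbaum-satisfies T-ext {γ} γ∈Γ σ =
    ⊣⊢-trans (⟦⟧-lindenbaum γ σ) (⊣⊢-intro 𝟙I (theory (T-ext γ∈Γ σ)))

  ⊨≤-lindenbaum : ∀ {Γ Δ φ χ σ} → ContainsInstances Γ T →
                  Δ ⊨≤[ Γ ] φ → (∀ {δ} → Δ δ → T (χ ⇒ δ [ σ ])) → T (χ ⇒ φ [ σ ])
  ⊨≤-lindenbaum {Γ} {φ = φ} {χ} {σ} T-ext Δ⊨≤φ χ≤Δ =
    discharge (⇒I (via (proj₁ (⟦⟧-lindenbaum φ σ)) (∧E₂ (via (proj₂ χ≤φ) #0))))
    where
    χ≤φ : χ ∧' ⟦ lindenbaum ⟧ φ σ ⊣⊢ χ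
    χ≤φ = Δ⊨≤φ lindenbaum (lindenbaum-satisfies {Γ} T-ext) σ χ λ {δ} δ∈Δ →
      ⊣⊢-intro (∧E₁ #0) (∧I #0 (via (proj₂ (⟦⟧-lindenbaum δ σ)) (via (χ≤Δ δ∈Δ) #0)))

-- LV + Γ with the extra axioms p₀ → δ(p₁, p₂, …) for δ ∈ Δ; shifting δ keeps p₀ fresh.
data Thm⁺ (Γ Δ : FSet) : Formula → Set where
  axiom : ∀ {φ} → Axiom φ → Thm⁺ Γ Δ φ
  ext   : ∀ {γ} → Γ γ → (σ : Subst) → Thm⁺ Γ Δ (γ [ σ ])
  below : ∀ {δ} → Δ δ → Thm⁺ Γ Δ (var 0 ⇒ δ [ shift ])
  mp    : ∀ {φ ψ} → Thm⁺ Γ Δ (φ ⇒ ψ) → Thm⁺ Γ Δ φ → Thm⁺ Γ Δ ψ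
  rcm   : ∀ {φ ψ} γ → Thm⁺ Γ Δ (φ ⇒ ψ) → Thm⁺ Γ Δ ((γ □⇒ φ) ⇒ (γ □⇒ ψ))

Thm⁺-isTheory : ∀ {Γ Δ} → IsTheory (Thm⁺ Γ Δ)
Thm⁺-isTheory = record { T-axiom = axiom ; T-mp = mp ; T-rcm = rcm }

⋀ : List Formula → Formula
⋀ []      = 𝟙
⋀ (φ ∷ L) = φ ∧' ⋀ L

module _ {Γ : FSet} where
  open Derivations (Thm Γ) axiom mp using (discharge; ⇒I; via; #0; ∧E₁; ∧E₂; 𝟙I)

  ⋀-elim : ∀ {φ L} → φ ∈ L → Thm Γ (⋀ L ⇒ φ)
  ⋀-elim (here refl)  = discharge (⇒I (∧E₁ #0))
  ⋀-elim (there φ∈L) = discharge (⇒I (via (⋀-elim φ∈L) (∧E₂ #0)))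

  ⊢-⋀ : ∀ {Δ L} → All Δ L → Δ ⊢[ Γ ] ⋀ L
  ⊢-⋀ []          = thm (discharge 𝟙I)
  ⊢-⋀ (δ∈Δ ∷ ΔL) = mp (mp (thm (axiom (ax-∧I _ _))) (hyp δ∈Δ)) (⊢-⋀ ΔL)

Thm⁺-instantiate : ∀ {Γ Δ ψ} → Thm⁺ Γ Δ ψ →
                   ∃[ L ] All Δ L × (∀ {L'} → L ⊆ L' → Thm Γ (ψ [ unshift (⋀ L') ]))
Thm⁺-instantiate (axiom ax)    = [] , [] , λ _ → axiom (Axiom-[] ax _)
Thm⁺-instantiate {Γ} (ext {γ} γ∈Γ σ) = [] , [] , λ {L'} _ →
  subst (Thm Γ) (≡.sym ([]-[] γ σ (unshift (⋀ L')))) (ext γ∈Γ _)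
Thm⁺-instantiate {Γ} (below {δ} δ∈Δ) = δ ∷ [] , δ∈Δ ∷ [] , λ {L'} δ⊆L' →
  subst (λ ψ → Thm Γ (⋀ L' ⇒ ψ)) (≡.sym ([]-shift-unshift δ (⋀ L'))) (⋀-elim (δ⊆L' (here refl)))
Thm⁺-instantiate (mp d e) with Thm⁺-instantiate d | Thm⁺-instantiate e
... | L₁ , ΔL₁ , inst₁ | L₂ , ΔL₂ , inst₂ = L₁ ++ L₂ , ++⁺ ΔL₁ ΔL₂ , λ L₁₂⊆L' →
  mp (inst₁ (⊆-trans (xs⊆xs++ys L₁ L₂) L₁₂⊆L')) (inst₂ (⊆-trans (xs⊆ys++xs L₂ L₁) L₁₂⊆L'))
Thm⁺-instantiate (rcm _ d) with Thm⁺-instantiate d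
... | L , ΔL , inst = L , ΔL , λ L⊆L' → rcm _ (inst L⊆L')

completeness : ∀ {Γ Δ φ} → Δ ⊨≤[ Γ ] φ → Δ ⊢[ Γ ] φ
completeness {Γ} {φ = φ} Δ⊨≤φ
  with Thm⁺-instantiate (Lindenbaum.⊨≤-lindenbaum Thm⁺-isTheory {φ = φ} ext Δ⊨≤φ below)
... | L , ΔL , inst = mp (thm ⊢⋀L⇒φ) (⊢-⋀ ΔL)
  where
  ⊢⋀L⇒φ : Thm Γ (⋀ L ⇒ φ)
  ⊢⋀L⇒φ = subst (λ ψ → Thm Γ (⋀ L ⇒ ψ)) ([]-shift-unshift φ (⋀ L)) (inst ⊆-refl)

corollary4p16 : ∀ (Γ Δ : FSet) (φ : Formula) →
    (Δ ⊢[ Γ ] φ → Δ ⊨≤[ Γ ] φ) × (Δ ⊨≤[ Γ ] φ → Δ ⊢[ Γ ] φ)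
corollary4p16 Γ Δ φ = soundness , completeness
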